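{- Let $n=2^r$, $n'=n/2$, and let $S=(x_1,\ldots,x_{n-1})$ be a sequence in $\mathbb{Z}_n$. Put $S_1=(x_1,\ldots,x_{n'-1})$ and $S_2=(x_{n'+1},\ldots,x_{n-1})$, and let $S_1'$ and $S_2'$ be the sequences in $\mathbb{Z}_{n'}$ obtained by dividing the terms of $S_1$ and $S_2$ (respectively) by two and taking their images under the natural map $\mathbb{Z}_n\to\mathbb{Z}_{n'}$. Then $S$ is a $C$-extremal sequence for $U(n)$ if and only if all terms of $S$ other than the middle term $x_{n'}$ are even, $x_{n'}$ is odd, and $S_1'$ and $S_2'$ are $C$-extremal sequences for $U(n')$ in $\mathbb{Z}_{n'}$.
   Context: $\mathbb{Z}_m=\mathbb{Z}/m\mathbb{Z}$ and $U(m)$ is its group of units; an element of $\mathbb{Z}_{2^r}$ is even/odd according to the parity of its integer representatives. For $A\subseteq\mathbb{Z}_m$, an $A$-weighted zero-sum subsequence of consecutive terms of a sequence $(x_1,\ldots,x_k)$ in $\mathbb{Z}_m$ is given by a non-empty set $I\subseteq[1,k]$ of consecutive integers and $a_i\in A$ ($i\in I$) with $\sum_{i\in I}a_ix_i=0$. $C_A(m)$ is the least positive integer $k$ such that every sequence of length $k$ in $\mathbb{Z}_m$ has such a subsequence. A $C$-extremal sequence for $A$ in $\mathbb{Z}_m$ is a sequence of length $C_A(m)-1$ in $\mathbb{Z}_m$ having no $A$-weighted zero-sum subsequence of consecutive terms. (It is known that $C_{U(2^s)}(2^s)=2^s$.) -}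

module Defs where

open import Level using (0ℓ)
open import Data.Nat using (ℕ; zero; suc; _+_; _*_; _∸_; _^_; _≤_; _<_; NonZero)
open import Data.Nat.Properties using (m^n≢0)
open import Data.Nat.Divisibility using (_∣_)
open import Data.Nat.DivMod using (_/_; _mod_)
open import Data.Fin using (Fin; toℕ)
open import Data.List using (List; []; _∷_; _++_; length; zipWith)
open import Data.Nat.ListAction using (sum)
open import Data.List.Relation.Unary.All using (All)
open import Data.Product using (Σ; ∃; _×_; _,_)
open import Relation.Nullary using (¬_)
open import Relation.Binary.PropositionalEquality using (_≡_)

-- Elements of ℤ_m are represented by Fin m (canonical residues 0..m-1).

≡0mod : ℕ → ℕ → Set
≡0mod m a = m ∣ a

-- Group of units U(m) ⊆ ℤ_m : a is a unit iff a * b = 1 in ℤ_m for some b,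
-- i.e. a*b ≡ 1 (mod m), written as m ∣ a*b + (m - 1)  (valid for m ≥ 1;
-- for m = 1 every element, namely 0 = 1, is a unit).
U : (m : ℕ) → Fin m → Set
U m a = Σ (Fin m) λ b → m ∣ (toℕ a * toℕ b + (m ∸ 1))

EvenF : ∀ {m} → Fin m → Set
EvenF x = 2 ∣ toℕ x

OddF : ∀ {m} → Fin m → Set
OddF x = ¬ (2 ∣ toℕ x)

wsum : ∀ {m} → List (Fin m) → List (Fin m) → ℕ
wsum as xs = sum (zipWith (λ a x → toℕ a * toℕ x) as xs)

HasCZS : (m : ℕ) → (Fin m → Set) → List (Fin m) → Set
HasCZS m A S =
  Σ (List (Fin m)) λ P → Σ (Fin m) λ t → Σ (List (Fin m)) λ T → Σ (List (Fin m)) λ Q →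
  S ≡ P ++ (t ∷ T) ++ Q ×
  Σ (List (Fin m)) λ ws →
    length ws ≡ length (t ∷ T) × All A ws × m ∣ wsum ws (t ∷ T)

IsC : (m : ℕ) → (Fin m → Set) → ℕ → Set
IsC m A k =
  1 ≤ k ×
  (∀ (S : List (Fin m)) → length S ≡ k → HasCZS m A S) ×
  (∀ j → 1 ≤ j → j < k →
     ¬ (∀ (S : List (Fin m)) → length S ≡ j → HasCZS m A S))

CExtremal : (m : ℕ) → (Fin m → Set) → List (Fin m) → Set
CExtremal m A S =
  Σ ℕ λ k → IsC m A k × length S ≡ k ∸ 1 × ¬ HasCZS m A S

-- The map ℤ_{2^(r+1)} → ℤ_{2^r}, x ↦ (x/2) mod 2^r (for even x this is
-- "divide by two, then reduce via the natural map").
half : (r : ℕ) → Fin (2 ^ suc r) → Fin (2 ^ r)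
half r x = _mod_ (toℕ x / 2) (2 ^ r) {{m^n≢0 2 r}}

-- Modulo 2^(r+1) the units are exactly the odd residues. The block from an odd term to the
-- next odd term can always be cancelled: give weight 1 to every term but the first and solve
-- for the first weight, which is a unit because the rest of the sum is odd. Hence a
-- zero-sum-free sequence has at most one odd term, and conversely a block through a single
-- odd term has odd weighted sum. A block of even terms has a unit-weighted zero sum modulo
-- 2^(r+1) exactly when its halves have one modulo 2^r, as unit weights reduce and lift between
-- the two moduli. By induction on r this gives C_{U(2^r)}(2^r) = 2^r, so the even runs of a
-- zero-sum-free sequence are shorter than 2^r; at length 2^(r+1) - 1 this puts the single odd
-- term exactly in the middle, with zero-sum-free halves on both sides.

module Submission where

open import Defs
open import Data.Nat using (ℕ; zero; suc; _+_; _*_; _∸_; _^_; _≤_; _<_; NonZero; s≤s; _≤?_)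
open import Data.Nat.Properties
open import Data.Nat.Divisibility
open import Data.Nat.DivMod
open import Data.Nat.Primality using (prime[2]; euclidsLemma; prime⇒irreducible)
open import Data.Nat.Coprimality using (Coprime; coprime-divisor; coprime-Bézout)
open import Data.Nat.GCD using (module Bézout)
open import Data.Nat.ListAction using (sum)
open import Data.Nat.Solver using (module +-*-Solver)
open import Data.Fin using (Fin; toℕ; fromℕ<; inject≤)
open import Data.Fin.Properties using (toℕ-fromℕ<; toℕ-inject≤; toℕ<n; toℕ-injective)
open import Data.List using (List; []; _∷_; _++_; length; map; zipWith; replicate; take; drop)
open import Data.List.Properties
  using (zipWith-map; length-map; length-replicate; length-++; length-take; take++drop≡id; ++-assoc; ∷-injective; map-++; map-∘; map-cong; map-id)
open import Data.List.Relation.Unary.First as First using (first)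
open import Data.List.Relation.Unary.First.Properties using (toView)
open import Data.List.Relation.Unary.All using (All; []; _∷_; universal) renaming (map to All-map)
open import Data.List.Relation.Unary.All.Properties using (map⁺; ++⁻ˡ; ++⁻ʳ; replicate⁺)
open import Data.Product using (Σ; ∃; ∃₂; _×_; _,_; proj₁; proj₂)
open import Data.Sum using (_⊎_; inj₁; inj₂)
open import Data.Empty using (⊥-elim)
open import Relation.Nullary using (¬_; yes; no)
open import Relation.Nullary.Decidable using (toSum)
open import Relation.Binary.PropositionalEquality
open import Function using (_∘_)
open import Function.Bundles using (_⇔_; mk⇔)

open +-*-Solver

¬2∣1 : ¬ 2 ∣ 1
¬2∣1 2∣1 with () ← ∣1⇒≡1 2∣1

odd*odd : ∀ {a b} → ¬ 2 ∣ a → ¬ 2 ∣ b → ¬ 2 ∣ a * b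
odd*odd {a} {b} a-odd b-odd 2∣ab with euclidsLemma a b prime[2] 2∣ab
... | inj₁ 2∣a = a-odd 2∣a
... | inj₂ 2∣b = b-odd 2∣b

odd+even : ∀ {a b} → ¬ 2 ∣ a → 2 ∣ b → ¬ 2 ∣ a + b
odd+even a-odd 2∣b 2∣a+b = a-odd (∣m+n∣n⇒∣m 2∣a+b 2∣b)
  where
  ∣m+n∣n⇒∣m : ∀ {d m n} → d ∣ m + n → d ∣ n → d ∣ m
  ∣m+n∣n⇒∣m {d} {m} {n} d∣m+n = ∣m+n∣m⇒∣n (subst (d ∣_) (+-comm m n) d∣m+n)

odd⇒coprime-2 : ∀ {a} → ¬ 2 ∣ a → Coprime a 2
odd⇒coprime-2 a-odd (d∣a , d∣2) with prime⇒irreducible prime[2] d∣2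
... | inj₁ d≡1 = d≡1
... | inj₂ refl = ⊥-elim (a-odd d∣a)

odd⇒coprime-2^ : ∀ s {a} → ¬ 2 ∣ a → Coprime a (2 ^ s)
odd⇒coprime-2^ zero    a-odd (_ , d∣1) = ∣1⇒≡1 d∣1
odd⇒coprime-2^ (suc s) a-odd (d∣a , d∣2^[1+s]) =
  odd⇒coprime-2^ s a-odd (d∣a , coprime-divisor (odd⇒coprime-2 (λ 2∣d → a-odd (∣-trans 2∣d d∣a))) d∣2^[1+s])

coprime-2^suc⇒odd : ∀ r {a} → Coprime a (2 ^ suc r) → ¬ 2 ∣ a
coprime-2^suc⇒odd r a⊥2^[1+r] 2∣a with () ← a⊥2^[1+r] (2∣a , m∣m*n (2 ^ r))

%-*ʳ : ∀ m n o .{{_ : NonZero o}} → (m * (n % o)) % o ≡ (m * n) % o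
%-*ʳ m n o = begin
  (m * (n % o)) % o           ≡⟨ %-distribˡ-* m (n % o) o ⟩
  (m % o * (n % o % o)) % o   ≡⟨ cong (λ t → (m % o * t) % o) (m%n%n≡m%n n o) ⟩
  (m % o * (n % o)) % o       ≡⟨ %-distribˡ-* m n o ⟨
  (m * n) % o                 ∎
  where open ≡-Reasoning

%-+-cong : ∀ {m n p q} o .{{_ : NonZero o}} → m % o ≡ n % o → p % o ≡ q % o → (m + p) % o ≡ (n + q) % o
%-+-cong {m} {n} {p} {q} o m≡n p≡q = begin
  (m + p) % o             ≡⟨ %-distribˡ-+ m p o ⟩
  (m % o + p % o) % o     ≡⟨ cong₂ (λ s t → (s + t) % o) m≡n p≡q ⟩
  (n % o + q % o) % o     ≡⟨ %-distribˡ-+ n q o ⟨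
  (n + q) % o             ∎
  where open ≡-Reasoning

toℕ-mod : ∀ m n .{{_ : NonZero n}} → toℕ (m mod n) ≡ m % n
toℕ-mod m n = toℕ-fromℕ< (m%n<n m n)

2^n≤2^[1+n] : ∀ n → 2 ^ n ≤ 2 ^ suc n
2^n≤2^[1+n] n = m≤m+n (2 ^ n) (2 ^ n + 0)

n∸1+[1+n∸1]≡2n∸1 : ∀ n .{{_ : NonZero n}} → (n ∸ 1) + suc (n ∸ 1) ≡ 2 * n ∸ 1
n∸1+[1+n∸1]≡2n∸1 (suc k) = cong (k +_) (sym (+-identityʳ (suc k)))

2n≤m+suc[k]⇒m<n⇒n≤k : ∀ {m n k} → 2 * n ≤ m + suc k → m < n → n ≤ k
2n≤m+suc[k]⇒m<n⇒n≤k {m} {n} {k} 2n≤ m<n = subst (_≤ k) (+-identityʳ n) (+-cancelˡ-≤ n (n + 0) k (begin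
  n + (n + 0)  ≤⟨ 2n≤ ⟩
  m + suc k    ≡⟨ +-suc m k ⟩
  suc m + k    ≤⟨ +-monoˡ-≤ k m<n ⟩
  n + k        ∎))
  where open ≤-Reasoning

m+suc[n]≡o+suc[o]⇒m≡o : ∀ {m n o} → m ≤ o → n ≤ o → m + suc n ≡ o + suc o → m ≡ o
m+suc[n]≡o+suc[o]⇒m≡o {m} {n} {o} m≤o n≤o eq = ≤-antisym m≤o (+-cancelʳ-≤ (suc o) o m (begin
  o + suc o  ≡⟨ eq ⟨
  m + suc n  ≤⟨ +-monoʳ-≤ m (s≤s n≤o) ⟩
  m + suc o  ∎))
  where open ≤-Reasoning


-- Units of ℤ_m

U⇒coprime : ∀ {m} (a : Fin m) → U m a → Coprime (toℕ a) m
U⇒coprime {suc k} a (b , m∣ab+k) {d} (d∣a , d∣1+k) =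
  ∣1⇒≡1 (∣m+n∣m⇒∣n (subst (d ∣_) (+-comm 1 k) d∣1+k) d∣k)
  where
  d∣k : d ∣ k
  d∣k = ∣m+n∣m⇒∣n (∣-trans d∣1+k m∣ab+k) (∣m⇒∣m*n (toℕ b) d∣a)

-- Bézout gives x a ≡ 1 or x a ≡ -1 modulo N = k + 1; take b = x (k c) ≡ -x c, resp. b = x c.
coprime⇒∃∣*+ : ∀ {N} .{{_ : NonZero N}} {a} → Coprime a N → ∀ c → ∃ λ b → N ∣ a * b + c
coprime⇒∃∣*+ {suc k} {a} a⊥N c with coprime-Bézout a⊥N
... | Bézout.+- x y 1+yN≡xa = x * (k * c) , divides (c + y * (k * c)) (begin
  a * (x * (k * c)) + c          ≡⟨ solve 4 (λ a x k c → a :* (x :* (k :* c)) :+ c := x :* a :* (k :* c) :+ c) refl a x k c ⟩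
  x * a * (k * c) + c            ≡⟨ cong (λ t → t * (k * c) + c) 1+yN≡xa ⟨
  (1 + y * suc k) * (k * c) + c  ≡⟨ solve 3 (λ y k c → (con 1 :+ y :* (con 1 :+ k)) :* (k :* c) :+ c
                                                     := (c :+ y :* (k :* c)) :* (con 1 :+ k)) refl y k c ⟩
  (c + y * (k * c)) * suc k      ∎)
  where open ≡-Reasoning
... | Bézout.-+ x y 1+xa≡yN = x * c , divides (y * c) (begin
  a * (x * c) + c                ≡⟨ solve 3 (λ a x c → a :* (x :* c) :+ c := (con 1 :+ x :* a) :* c) refl a x c ⟩
  (1 + x * a) * c                ≡⟨ cong (_* c) 1+xa≡yN ⟩
  y * suc k * c                  ≡⟨ solve 3 (λ y k c → y :* (con 1 :+ k) :* c := y :* c :* (con 1 :+ k)) refl y k c ⟩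
  y * c * suc k                  ∎)
  where open ≡-Reasoning

coprime⇒∃Fin∣*+ : ∀ {N} .{{_ : NonZero N}} {a} → Coprime a N → ∀ c → Σ (Fin N) λ b → N ∣ a * toℕ b + c
coprime⇒∃Fin∣*+ {N} {a} a⊥N c with b , N∣ab+c ← coprime⇒∃∣*+ a⊥N c =
  b mod N , m%n≡0⇒n∣m _ N (begin
    (a * toℕ (b mod N) + c) % N  ≡⟨ %-+-cong N (cong (λ t → (a * t) % N) (toℕ-mod b N)) refl ⟩
    (a * (b % N) + c) % N        ≡⟨ %-+-cong N (%-*ʳ a b N) refl ⟩
    (a * b + c) % N              ≡⟨ n∣m⇒m%n≡0 _ N N∣ab+c ⟩
    0                            ∎)
  where open ≡-Reasoning

coprime⇒U : ∀ {m} (a : Fin m) → Coprime (toℕ a) m → U m a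
coprime⇒U {suc k} a a⊥m = coprime⇒∃Fin∣*+ a⊥m k

∣*+⇒coprime : ∀ {N a b c} → N ∣ a * b + c → Coprime c N → Coprime b N
∣*+⇒coprime {a = a} N∣ab+c c⊥N (d∣b , d∣N) = c⊥N (∣m+n∣m⇒∣n (∣-trans d∣N N∣ab+c) (∣n⇒∣m*n a d∣b) , d∣N)

coprime-% : ∀ {a m n} .{{_ : NonZero n}} → Coprime a m → n ∣ m → Coprime (a % n) n
coprime-% a⊥m n∣m (d∣a%n , d∣n) = a⊥m (∣n∣m%n⇒∣m d∣n d∣a%n , ∣-trans d∣n n∣m)

U⇒odd : ∀ r (a : Fin (2 ^ suc r)) → U (2 ^ suc r) a → OddF a
U⇒odd r a = coprime-2^suc⇒odd r ∘ U⇒coprime a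

odd⇒U : ∀ s (a : Fin (2 ^ s)) → OddF a → U (2 ^ s) a
odd⇒U s a = coprime⇒U a ∘ odd⇒coprime-2^ s

U[1] : (a : Fin 1) → U 1 a
U[1] a = coprime⇒U a λ (_ , d∣1) → ∣1⇒≡1 d∣1


embed : ∀ r → Fin (2 ^ r) → Fin (2 ^ suc r)
embed r w = inject≤ w (2^n≤2^[1+n] r)

reduce : ∀ r → Fin (2 ^ suc r) → Fin (2 ^ r)
reduce r w = _mod_ (toℕ w) (2 ^ r) {{m^n≢0 2 r}}

double : ∀ r → Fin (2 ^ r) → Fin (2 ^ suc r)
double r y = fromℕ< (*-monoʳ-< 2 (toℕ<n y))

one : ∀ r → Fin (2 ^ suc r)
one r = fromℕ< (*-monoʳ-≤ 2 (m^n>0 2 r))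

one-odd : ∀ r → OddF (one r)
one-odd r 2∣1 = ¬2∣1 (subst (2 ∣_) (toℕ-fromℕ< _) 2∣1)

toℕ-half : ∀ r (x : Fin (2 ^ suc r)) → toℕ (half r x) ≡ toℕ x / 2
toℕ-half r x = trans (toℕ-mod (toℕ x / 2) (2 ^ r) {{m^n≢0 2 r}})
  (m<n⇒m%n≡m {{m^n≢0 2 r}} (m<n*o⇒m/o<n (subst (toℕ x <_) (*-comm 2 (2 ^ r)) (toℕ<n x))))

even⇒≡2*half : ∀ r (x : Fin (2 ^ suc r)) → EvenF x → toℕ x ≡ 2 * toℕ (half r x)
even⇒≡2*half r x 2∣x = trans (sym (m*[n/m]≡n 2∣x)) (cong (2 *_) (sym (toℕ-half r x)))

half-double : ∀ r (y : Fin (2 ^ r)) → half r (double r y) ≡ y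
half-double r y = toℕ-injective (begin
  toℕ (half r (double r y))   ≡⟨ toℕ-half r (double r y) ⟩
  toℕ (double r y) / 2        ≡⟨ cong (_/ 2) (trans (toℕ-fromℕ< _) (*-comm 2 (toℕ y))) ⟩
  toℕ y * 2 / 2               ≡⟨ m*n/n≡m (toℕ y) 2 ⟩
  toℕ y                       ∎)
  where open ≡-Reasoning

double-even : ∀ r (y : Fin (2 ^ r)) → EvenF (double r y)
double-even r y = divides (toℕ y) (trans (toℕ-fromℕ< _) (*-comm 2 (toℕ y)))

embed-U : ∀ r {w : Fin (2 ^ suc r)} → U (2 ^ suc r) w → U (2 ^ suc (suc r)) (embed (suc r) w)
embed-U r {w} w∈U = odd⇒U (suc (suc r)) (embed (suc r) w)
  (U⇒odd r w w∈U ∘ subst (2 ∣_) (toℕ-inject≤ w (2^n≤2^[1+n] (suc r))))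

reduce-U : ∀ r {w : Fin (2 ^ suc r)} → U (2 ^ suc r) w → U (2 ^ r) (reduce r w)
reduce-U r {w} w∈U = coprime⇒U (reduce r w)
  (subst (λ t → Coprime t (2 ^ r)) (sym (toℕ-mod (toℕ w) (2 ^ r) {{m^n≢0 2 r}}))
    (coprime-% {{m^n≢0 2 r}} (U⇒coprime w w∈U) (n∣m*n 2)))


-- The weighted sum with the modulus forgotten, so that weights and terms can be moved
-- between ℤ_{2^r} and ℤ_{2^(r+1)}.
dot : List ℕ → List ℕ → ℕ
dot as bs = sum (zipWith _*_ as bs)

wsum≡dot : ∀ {m} (ws xs : List (Fin m)) → wsum ws xs ≡ dot (map toℕ ws) (map toℕ xs)
wsum≡dot ws xs = cong sum (sym (zipWith-map _*_ toℕ toℕ ws xs))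

dot-*ʳ : ∀ k as bs → dot as (map (k *_) bs) ≡ k * dot as bs
dot-*ʳ k []       bs       = sym (*-zeroʳ k)
dot-*ʳ k (a ∷ as) []       = sym (*-zeroʳ k)
dot-*ʳ k (a ∷ as) (b ∷ bs) = begin
  a * (k * b) + dot as (map (k *_) bs)  ≡⟨ cong (a * (k * b) +_) (dot-*ʳ k as bs) ⟩
  a * (k * b) + k * dot as bs           ≡⟨ solve 4 (λ a b k d → a :* (k :* b) :+ k :* d := k :* (a :* b :+ d)) refl a b k (dot as bs) ⟩
  k * (a * b + dot as bs)               ∎
  where open ≡-Reasoning

dot-%ˡ : ∀ N .{{_ : NonZero N}} as bs → dot (map (_% N) as) bs % N ≡ dot as bs % N
dot-%ˡ N []       bs       = refl
dot-%ˡ N (a ∷ as) []       = refl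
dot-%ˡ N (a ∷ as) (b ∷ bs) = %-+-cong N %-*ˡ (dot-%ˡ N as bs)
  where
  %-*ˡ : (a % N * b) % N ≡ (a * b) % N
  %-*ˡ = trans (cong (_% N) (*-comm (a % N) b)) (trans (%-*ʳ b a N) (cong (_% N) (*-comm b a)))

wsum-even : ∀ {m} (ws B : List (Fin m)) → All EvenF B → 2 ∣ wsum ws B
wsum-even []       B        _          = 2 ∣0
wsum-even (w ∷ ws) []       _          = 2 ∣0
wsum-even (w ∷ ws) (x ∷ xs) (2∣x ∷ es) = ∣m∣n⇒∣m+n (∣n⇒∣m*n (toℕ w) 2∣x) (wsum-even ws xs es)

wsum-odd : ∀ {m} (ws B₁ : List (Fin m)) x B₂ → length ws ≡ length (B₁ ++ x ∷ B₂) → All OddF ws →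
  All EvenF B₁ → OddF x → All EvenF B₂ → ¬ 2 ∣ wsum ws (B₁ ++ x ∷ B₂)
wsum-odd (w ∷ ws) []       x B₂ _   (w-odd ∷ _) _          x-odd eB₂ =
  odd+even (odd*odd w-odd x-odd) (wsum-even ws B₂ eB₂)
wsum-odd (w ∷ ws) (b ∷ B₁) x B₂ len (_ ∷ oW)    (2∣b ∷ eB₁) x-odd eB₂ 2∣sum =
  wsum-odd ws B₁ x B₂ (suc-injective len) oW eB₁ x-odd eB₂ (∣m+n∣m⇒∣n 2∣sum (∣n⇒∣m*n (toℕ w) 2∣b))

map-toℕ-evens : ∀ r {B : List (Fin (2 ^ suc r))} → All EvenF B → map toℕ B ≡ map (2 *_) (map toℕ (map (half r) B))
map-toℕ-evens r []         = refl
map-toℕ-evens r (e ∷ es) = cong₂ _∷_ (even⇒≡2*half r _ e) (map-toℕ-evens r es)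

wsum-evens : ∀ r (ws B : List (Fin (2 ^ suc r))) → All EvenF B →
  wsum ws B ≡ 2 * dot (map toℕ ws) (map toℕ (map (half r) B))
wsum-evens r ws B eB = begin
  wsum ws B                                                ≡⟨ wsum≡dot ws B ⟩
  dot (map toℕ ws) (map toℕ B)                             ≡⟨ cong (dot (map toℕ ws)) (map-toℕ-evens r eB) ⟩
  dot (map toℕ ws) (map (2 *_) (map toℕ (map (half r) B))) ≡⟨ dot-*ʳ 2 (map toℕ ws) _ ⟩
  2 * dot (map toℕ ws) (map toℕ (map (half r) B))          ∎
  where open ≡-Reasoning


module _ {X : Set} where

  ++-≡-++-∷ : ∀ (B Q S₁ : List X) x S₂ → B ++ Q ≡ S₁ ++ x ∷ S₂ →
    (∃ λ Q′ → S₁ ≡ B ++ Q′) ⊎ (∃ λ B₂ → B ≡ S₁ ++ x ∷ B₂ × S₂ ≡ B₂ ++ Q)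
  ++-≡-++-∷ []      Q S₁       x S₂ _  = inj₁ (S₁ , refl)
  ++-≡-++-∷ (b ∷ B) Q []       x S₂ eq with refl , B++Q≡S₂ ← ∷-injective eq = inj₂ (B , refl , sym B++Q≡S₂)
  ++-≡-++-∷ (b ∷ B) Q (s ∷ S₁) x S₂ eq with refl , eq′ ← ∷-injective eq with ++-≡-++-∷ B Q S₁ x S₂ eq′
  ... | inj₁ (Q′ , refl)        = inj₁ (Q′ , refl)
  ... | inj₂ (B₂ , refl , S₂≡)  = inj₂ (B₂ , refl , S₂≡)

  ++-++-≡-++-∷ : ∀ (P B Q S₁ : List X) x S₂ → P ++ B ++ Q ≡ S₁ ++ x ∷ S₂ →
      (∃ λ Q′ → S₁ ≡ P ++ B ++ Q′)
    ⊎ (∃ λ P′ → S₂ ≡ P′ ++ B ++ Q)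
    ⊎ (∃₂ λ B₁ B₂ → B ≡ B₁ ++ x ∷ B₂ × (∃ λ P₁ → S₁ ≡ P₁ ++ B₁) × (∃ λ Q₂ → S₂ ≡ B₂ ++ Q₂))
  ++-++-≡-++-∷ [] B Q S₁ x S₂ eq with ++-≡-++-∷ B Q S₁ x S₂ eq
  ... | inj₁ inS₁               = inj₁ inS₁
  ... | inj₂ (B₂ , B≡ , S₂≡)    = inj₂ (inj₂ (S₁ , B₂ , B≡ , ([] , refl) , (Q , S₂≡)))
  ++-++-≡-++-∷ (p ∷ P) B Q [] x S₂ eq with refl , P++B++Q≡S₂ ← ∷-injective eq = inj₂ (inj₁ (P , sym P++B++Q≡S₂))
  ++-++-≡-++-∷ (p ∷ P) B Q (s ∷ S₁) x S₂ eq with refl , eq′ ← ∷-injective eq with ++-++-≡-++-∷ P B Q S₁ x S₂ eq′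
  ... | inj₁ (Q′ , refl)        = inj₁ (Q′ , refl)
  ... | inj₂ (inj₁ inS₂)        = inj₂ (inj₁ inS₂)
  ... | inj₂ (inj₂ (B₁ , B₂ , B≡ , (P₁ , refl) , suf)) = inj₂ (inj₂ (B₁ , B₂ , B≡ , (p ∷ P₁ , refl) , suf))

  map-≡-++ : ∀ {Y : Set} (f : X → Y) L B C → map f L ≡ B ++ C →
    ∃₂ λ L₁ L₂ → L ≡ L₁ ++ L₂ × map f L₁ ≡ B × map f L₂ ≡ C
  map-≡-++ f L       []      C eq = [] , L , refl , refl , eq
  map-≡-++ f (l ∷ L) (b ∷ B) C eq with fl≡b , eq′ ← ∷-injective eq with map-≡-++ f L B C eq′
  ... | L₁ , L₂ , refl , refl , refl = l ∷ L₁ , L₂ , refl , cong (_∷ map f L₁) fl≡b , refl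

  ++-∷-injective : ∀ (xs ys : List X) {x y zs ws} → length xs ≡ length ys →
    xs ++ x ∷ zs ≡ ys ++ y ∷ ws → xs ≡ ys × x ≡ y × zs ≡ ws
  ++-∷-injective []       []       _   eq with refl , refl ← ∷-injective eq = refl , refl , refl
  ++-∷-injective (x ∷ xs) (y ∷ ys) len eq with refl , eq′ ← ∷-injective eq
    with refl , refl , refl ← ++-∷-injective xs ys (suc-injective len) eq′ = refl , refl , refl

WeightedZeroSum : (m : ℕ) → (Fin m → Set) → List (Fin m) → Set
WeightedZeroSum m A B = Σ (List (Fin m)) λ ws → length ws ≡ length B × All A ws × m ∣ wsum ws B

module _ {m : ℕ} {A : Fin m → Set} where

  ¬HasCZS[] : ¬ HasCZS m A []
  ¬HasCZS[] ([]    , _ , _ , _ , () , _)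
  ¬HasCZS[] (_ ∷ _ , _ , _ , _ , () , _)

  HasCZS-++⁺ˡ : ∀ {L} M → HasCZS m A L → HasCZS m A (L ++ M)
  HasCZS-++⁺ˡ M (P , t , T , Q , refl , z) =
    P , t , T , Q ++ M , trans (++-assoc P (t ∷ T ++ Q) M) (cong (λ R → P ++ t ∷ R) (++-assoc T Q M)) , z

  HasCZS-++⁺ʳ : ∀ L {M} → HasCZS m A M → HasCZS m A (L ++ M)
  HasCZS-++⁺ʳ L (P , t , T , Q , refl , z) = L ++ P , t , T , Q , sym (++-assoc L P (t ∷ T ++ Q)) , z

module _ {m : ℕ} {A : Fin m → Set} where

  HasCZS-++-∷⁻ : ∀ S₁ x S₂ → HasCZS m A (S₁ ++ x ∷ S₂) →
    HasCZS m A S₁ ⊎ HasCZS m A S₂ ⊎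
    (∃₂ λ B₁ B₂ → (∃ λ P₁ → S₁ ≡ P₁ ++ B₁) × (∃ λ Q₂ → S₂ ≡ B₂ ++ Q₂) × WeightedZeroSum m A (B₁ ++ x ∷ B₂))
  HasCZS-++-∷⁻ S₁ x S₂ (P , t , T , Q , eq , z) with ++-++-≡-++-∷ P (t ∷ T) Q S₁ x S₂ (sym eq)
  ... | inj₁ (Q′ , S₁≡)                        = inj₁ (P , t , T , Q′ , S₁≡ , z)
  ... | inj₂ (inj₁ (P′ , S₂≡))                 = inj₂ (inj₁ (P′ , t , T , Q , S₂≡ , z))
  ... | inj₂ (inj₂ (B₁ , B₂ , B≡ , pre , suf)) = inj₂ (inj₂ (B₁ , B₂ , pre , suf , subst (WeightedZeroSum m A) B≡ z))

module _ {m n : ℕ} {A : Fin m → Set} {A′ : Fin n → Set} {P : Fin m → Set} (f : Fin m → Fin n) where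

  HasCZS-map⁺ : (∀ {B} → All P B → WeightedZeroSum m A B → WeightedZeroSum n A′ (map f B)) →
    ∀ {L} → All P L → HasCZS m A L → HasCZS n A′ (map f L)
  HasCZS-map⁺ transfer {L} pL (P₀ , t , T , Q , refl , z) =
    map f P₀ , f t , map f T , map f Q ,
    trans (map-++ f P₀ (t ∷ T ++ Q)) (cong (λ R → map f P₀ ++ f t ∷ R) (map-++ f T Q)) ,
    transfer (++⁻ˡ (t ∷ T) (++⁻ʳ P₀ pL)) z

  HasCZS-map⁻ : (∀ {B} → All P B → WeightedZeroSum n A′ (map f B) → WeightedZeroSum m A B) →
    ∀ {L} → All P L → HasCZS n A′ (map f L) → HasCZS m A L
  HasCZS-map⁻ transfer {L} pL (P′ , t′ , T′ , Q′ , eq , z)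
    with L₁ , L₂ , refl , _ , eq₂ ← map-≡-++ f L P′ _ eq
    with map-≡-++ f L₂ (t′ ∷ T′) Q′ eq₂
  ... | l ∷ L₃ , L₄ , refl , fB≡ , _ =
    L₁ , l , L₃ , L₄ , refl , transfer (++⁻ˡ (l ∷ L₃) (++⁻ʳ L₁ pL)) (subst (WeightedZeroSum n A′) (sym fB≡) z)

length-++-∷ : ∀ r {X : Set} (S₁ : List X) x S₂ → length S₁ ≡ 2 ^ r ∸ 1 → length S₂ ≡ 2 ^ r ∸ 1 →
  length (S₁ ++ x ∷ S₂) ≡ 2 ^ suc r ∸ 1
length-++-∷ r S₁ x S₂ len₁ len₂ =
  trans (length-++ S₁) (trans (cong₂ (λ a b → a + suc b) len₁ len₂) (n∸1+[1+n∸1]≡2n∸1 (2 ^ r) {{m^n≢0 2 r}}))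


-- Halving blocks of even terms

WeightedZeroSum-half : ∀ r {B} → All EvenF B →
  WeightedZeroSum (2 ^ suc r) (U (2 ^ suc r)) B → WeightedZeroSum (2 ^ r) (U (2 ^ r)) (map (half r) B)
WeightedZeroSum-half r {B} eB (ws , len , ws∈U , 2^[1+r]∣) =
  map (reduce r) ws ,
  trans (length-map (reduce r) ws) (trans len (sym (length-map (half r) B))) ,
  map⁺ {f = reduce r} (All-map (λ {w} → reduce-U r {w}) ws∈U) ,
  subst (2 ^ r ∣_) (sym (wsum≡dot (map (reduce r) ws) hB)) (m%n≡0⇒n∣m _ (2 ^ r) (begin
    dot (map toℕ (map (reduce r) ws)) (map toℕ hB) % 2 ^ r  ≡⟨ cong (λ as → dot as (map toℕ hB) % 2 ^ r) toℕ-reduce ⟩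
    dot (map (%N) (map toℕ ws)) (map toℕ hB) % 2 ^ r        ≡⟨ dot-%ˡ (2 ^ r) (map toℕ ws) (map toℕ hB) ⟩
    dot (map toℕ ws) (map toℕ hB) % 2 ^ r                   ≡⟨ n∣m⇒m%n≡0 _ (2 ^ r) 2^r∣dot ⟩
    0                                                       ∎))
  where
  open ≡-Reasoning
  instance
    2^r≢0 : NonZero (2 ^ r)
    2^r≢0 = m^n≢0 2 r
  hB = map (half r) B
  %N : ℕ → ℕ
  %N a = a % 2 ^ r
  toℕ-reduce : map toℕ (map (reduce r) ws) ≡ map %N (map toℕ ws)
  toℕ-reduce = trans (sym (map-∘ ws)) (trans (map-cong (λ w → toℕ-mod (toℕ w) (2 ^ r)) ws) (map-∘ ws))
  2^r∣dot : 2 ^ r ∣ dot (map toℕ ws) (map toℕ hB)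
  2^r∣dot = *-cancelˡ-∣ 2 (subst (2 ^ suc r ∣_) (wsum-evens r ws B eB) 2^[1+r]∣)

WeightedZeroSum-unhalf : ∀ r {B} → All EvenF B →
  WeightedZeroSum (2 ^ r) (U (2 ^ r)) (map (half r) B) → WeightedZeroSum (2 ^ suc r) (U (2 ^ suc r)) B
-- Weights in ℤ_1, where 0 is a unit, need not lift to units of ℤ_2; but modulo 2 the weights
-- 1 already cancel any block of even terms.
WeightedZeroSum-unhalf zero {B} eB _ =
  replicate (length B) (one 0) , length-replicate (length B) ,
  replicate⁺ (length B) (odd⇒U 1 (one 0) (one-odd 0)) , wsum-even (replicate (length B) (one 0)) B eB
WeightedZeroSum-unhalf (suc r) {B} eB (ws , len , ws∈U , 2^[1+r]∣) =
  map (embed (suc r)) ws ,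
  trans (length-map (embed (suc r)) ws) (trans len (length-map (half (suc r)) B)) ,
  map⁺ {f = embed (suc r)} (All-map (λ {w} → embed-U r {w}) ws∈U) ,
  subst (2 ^ suc (suc r) ∣_) (sym wsum≡2*wsum) (*-monoʳ-∣ 2 2^[1+r]∣)
  where
  open ≡-Reasoning
  hB = map (half (suc r)) B
  toℕ-embed : map toℕ (map (embed (suc r)) ws) ≡ map toℕ ws
  toℕ-embed = trans (sym (map-∘ ws)) (map-cong (λ w → toℕ-inject≤ w (2^n≤2^[1+n] (suc r))) ws)
  wsum≡2*wsum : wsum (map (embed (suc r)) ws) B ≡ 2 * wsum ws hB
  wsum≡2*wsum = begin
    wsum (map (embed (suc r)) ws) B                         ≡⟨ wsum-evens (suc r) (map (embed (suc r)) ws) B eB ⟩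
    2 * dot (map toℕ (map (embed (suc r)) ws)) (map toℕ hB) ≡⟨ cong (λ as → 2 * dot as (map toℕ hB)) toℕ-embed ⟩
    2 * dot (map toℕ ws) (map toℕ hB)                       ≡⟨ cong (2 *_) (wsum≡dot ws hB) ⟨
    2 * wsum ws hB                                          ∎

HasCZS-half : ∀ r {L} → All EvenF L →
  HasCZS (2 ^ suc r) (U (2 ^ suc r)) L → HasCZS (2 ^ r) (U (2 ^ r)) (map (half r) L)
HasCZS-half r = HasCZS-map⁺ (half r) (WeightedZeroSum-half r)

HasCZS-unhalf : ∀ r {L} → All EvenF L →
  HasCZS (2 ^ r) (U (2 ^ r)) (map (half r) L) → HasCZS (2 ^ suc r) (U (2 ^ suc r)) L
HasCZS-unhalf r = HasCZS-map⁻ (half r) (WeightedZeroSum-unhalf r)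


-- Odd terms and the value of C_{U(2^s)}(2^s)

odd-evens-odd⇒WeightedZeroSum : ∀ r {o₁ o₂ : Fin (2 ^ suc r)} {E} → OddF o₁ → All EvenF E → OddF o₂ →
  WeightedZeroSum (2 ^ suc r) (U (2 ^ suc r)) (o₁ ∷ E ++ o₂ ∷ [])
odd-evens-odd⇒WeightedZeroSum r {o₁} {o₂} {E} o₁-odd eE o₂-odd =
  w ∷ ones , cong suc (length-replicate _) , w∈U ∷ replicate⁺ _ (odd⇒U (suc r) (one r) (one-odd r)) ,
  subst (2 ^ suc r ∣_) (cong (_+ R) (*-comm (toℕ o₁) (toℕ w))) 2^[1+r]∣o₁w+R
  where
  ones = replicate (length (E ++ o₂ ∷ [])) (one r)
  R = wsum ones (E ++ o₂ ∷ [])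
  R-odd : ¬ 2 ∣ R
  R-odd = wsum-odd ones E o₂ [] (length-replicate _) (replicate⁺ _ (one-odd r)) eE o₂-odd []
  solution : Σ (Fin (2 ^ suc r)) λ b → 2 ^ suc r ∣ toℕ o₁ * toℕ b + R
  solution = coprime⇒∃Fin∣*+ {{m^n≢0 2 (suc r)}} (odd⇒coprime-2^ (suc r) o₁-odd) R
  w = proj₁ solution
  2^[1+r]∣o₁w+R = proj₂ solution
  w∈U : U (2 ^ suc r) w
  w∈U = coprime⇒U w (∣*+⇒coprime {a = toℕ o₁} 2^[1+r]∣o₁w+R (odd⇒coprime-2^ (suc r) R-odd))

data AtMostOneOdd {m} (L : List (Fin m)) : Set where
  allEven : All EvenF L → AtMostOneOdd L
  oneOdd  : ∀ E o E′ → L ≡ E ++ o ∷ E′ → All EvenF E → OddF o → All EvenF E′ → AtMostOneOdd L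

evenOrOdd : ∀ {m} (x : Fin m) → EvenF x ⊎ OddF x
evenOrOdd x = toSum (2 ∣? toℕ x)

HasCZS⊎AtMostOneOdd : ∀ r (L : List (Fin (2 ^ suc r))) → HasCZS (2 ^ suc r) (U (2 ^ suc r)) L ⊎ AtMostOneOdd L
HasCZS⊎AtMostOneOdd r L with first evenOrOdd L
... | inj₂ eL = inj₂ (allEven eL)
... | inj₁ oddInL with toView oddInL
...   | First._++_∷_ {E} {o} eE o-odd M with first evenOrOdd M
...     | inj₂ eM = inj₂ (oneOdd E o M refl eE o-odd eM)
...     | inj₁ oddInM with toView oddInM
...       | First._++_∷_ {E′} {o′} eE′ o′-odd M′ =
  inj₁ (E , o , E′ ++ o′ ∷ [] , M′ , cong (λ R → E ++ o ∷ R) (sym (++-assoc E′ (o′ ∷ []) M′)) ,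
        odd-evens-odd⇒WeightedZeroSum r o-odd eE′ o′-odd)

HasCZS-of-length≥2^s : ∀ s (L : List (Fin (2 ^ s))) → 2 ^ s ≤ length L → HasCZS (2 ^ s) (U (2 ^ s)) L
HasCZS-evens-of-length≥2^r : ∀ r (L : List (Fin (2 ^ suc r))) → All EvenF L → 2 ^ r ≤ length L →
  HasCZS (2 ^ suc r) (U (2 ^ suc r)) L

HasCZS-of-length≥2^s zero (l ∷ L) _ = [] , l , [] , L , refl , l ∷ [] , refl , U[1] l ∷ [] , 1∣ _
HasCZS-of-length≥2^s (suc r) L 2^[1+r]≤ with HasCZS⊎AtMostOneOdd r L
... | inj₁ hasCZS = hasCZS
... | inj₂ (allEven eL) = HasCZS-evens-of-length≥2^r r L eL (≤-trans (2^n≤2^[1+n] r) 2^[1+r]≤)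
... | inj₂ (oneOdd E o E′ refl eE _ eE′) with 2 ^ r ≤? length E
...   | yes 2^r≤E = HasCZS-++⁺ˡ (o ∷ E′) (HasCZS-evens-of-length≥2^r r E eE 2^r≤E)
...   | no  2^r≰E = HasCZS-++⁺ʳ E (HasCZS-++⁺ʳ (o ∷ []) (HasCZS-evens-of-length≥2^r r E′ eE′
          (2n≤m+suc[k]⇒m<n⇒n≤k (subst (2 ^ suc r ≤_) (length-++ E) 2^[1+r]≤) (≰⇒> 2^r≰E))))

HasCZS-evens-of-length≥2^r r L eL 2^r≤ = HasCZS-unhalf r eL (HasCZS-of-length≥2^s r (map (half r) L) (subst (2 ^ r ≤_) (sym (length-map (half r) L)) 2^r≤))

¬HasCZS-++-∷⁺ : ∀ r (S₁ : List (Fin (2 ^ suc r))) x S₂ → All EvenF S₁ → All EvenF S₂ → OddF x →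
  ¬ HasCZS (2 ^ r) (U (2 ^ r)) (map (half r) S₁) → ¬ HasCZS (2 ^ r) (U (2 ^ r)) (map (half r) S₂) →
  ¬ HasCZS (2 ^ suc r) (U (2 ^ suc r)) (S₁ ++ x ∷ S₂)
¬HasCZS-++-∷⁺ r S₁ x S₂ eS₁ eS₂ x-odd free₁ free₂ hasCZS with HasCZS-++-∷⁻ S₁ x S₂ hasCZS
... | inj₁ inS₁ = free₁ (HasCZS-half r eS₁ inS₁)
... | inj₂ (inj₁ inS₂) = free₂ (HasCZS-half r eS₂ inS₂)
... | inj₂ (inj₂ (B₁ , B₂ , (P₁ , refl) , (Q₂ , refl) , ws , len , ws∈U , 2^[1+r]∣)) =
  wsum-odd ws B₁ x B₂ len (All-map (λ {w} → U⇒odd r w) ws∈U) (++⁻ʳ P₁ eS₁) x-odd (++⁻ˡ B₂ eS₂)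
    (∣-trans (m∣m*n (2 ^ r)) 2^[1+r]∣)

∃¬HasCZS : ∀ s → Σ (List (Fin (2 ^ s))) λ E → length E ≡ 2 ^ s ∸ 1 × ¬ HasCZS (2 ^ s) (U (2 ^ s)) E
∃¬HasCZS zero = [] , refl , ¬HasCZS[]
∃¬HasCZS (suc r) with E , len , free ← ∃¬HasCZS r =
  D ++ one r ∷ D , length-++-∷ r D (one r) D lenD lenD , ¬HasCZS-++-∷⁺ r D (one r) D eD eD (one-odd r) freeD freeD
  where
  D = map (double r) E
  lenD : length D ≡ 2 ^ r ∸ 1
  lenD = trans (length-map (double r) E) len
  eD : All EvenF D
  eD = map⁺ (universal (double-even r) E)
  freeD : ¬ HasCZS (2 ^ r) (U (2 ^ r)) (map (half r) D)
  freeD = free ∘ subst (HasCZS (2 ^ r) (U (2 ^ r))) (trans (sym (map-∘ E)) (trans (map-cong (half-double r) E) (map-id E)))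

C[2^s]≡2^s : ∀ s → IsC (2 ^ s) (U (2 ^ s)) (2 ^ s)
C[2^s]≡2^s s = m^n>0 2 s , (λ S len → HasCZS-of-length≥2^s s S (≤-reflexive (sym len))) , shorter
  where
  shorter : ∀ j → 1 ≤ j → j < 2 ^ s → ¬ (∀ (S : List (Fin (2 ^ s))) → length S ≡ j → HasCZS (2 ^ s) (U (2 ^ s)) S)
  shorter j _ j<2^s all-j with E , len , free ← ∃¬HasCZS s =
    free (subst (HasCZS (2 ^ s) (U (2 ^ s))) (take++drop≡id j E)
      (HasCZS-++⁺ˡ (drop j E) (all-j (take j E) (trans (length-take j E) (m≤n⇒m⊓n≡m j≤E)))))
    where
    j≤E : j ≤ length E
    j≤E = subst (j ≤_) (sym len) (∸-monoˡ-≤ 1 j<2^s)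

¬HasCZS⇒CExtremal : ∀ s (S : List (Fin (2 ^ s))) → length S ≡ 2 ^ s ∸ 1 →
  ¬ HasCZS (2 ^ s) (U (2 ^ s)) S → CExtremal (2 ^ s) (U (2 ^ s)) S
¬HasCZS⇒CExtremal s S len free = 2 ^ s , C[2^s]≡2^s s , len , free


¬HasCZS⇒middleOdd : ∀ r (L : List (Fin (2 ^ suc r))) → length L ≡ 2 ^ suc r ∸ 1 →
  ¬ HasCZS (2 ^ suc r) (U (2 ^ suc r)) L →
  Σ (List (Fin (2 ^ suc r))) λ E → Σ (Fin (2 ^ suc r)) λ o → Σ (List (Fin (2 ^ suc r))) λ E′ →
    L ≡ E ++ o ∷ E′ × length E ≡ 2 ^ r ∸ 1 × All EvenF E × OddF o × All EvenF E′
¬HasCZS⇒middleOdd r L len free with HasCZS⊎AtMostOneOdd r L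
... | inj₁ hasCZS = ⊥-elim (free hasCZS)
... | inj₂ (allEven eL) = ⊥-elim (free (HasCZS-evens-of-length≥2^r r L eL (begin
  2 ^ r                          ≡⟨ suc-pred (2 ^ r) {{m^n≢0 2 r}} ⟨
  suc (2 ^ r ∸ 1)                ≤⟨ m≤n+m _ _ ⟩
  (2 ^ r ∸ 1) + suc (2 ^ r ∸ 1)  ≡⟨ n∸1+[1+n∸1]≡2n∸1 (2 ^ r) {{m^n≢0 2 r}} ⟩
  2 ^ suc r ∸ 1                  ≡⟨ len ⟨
  length L                       ∎)))
  where open ≤-Reasoning
... | inj₂ (oneOdd E o E′ refl eE o-odd eE′) = E , o , E′ , refl , lenE , eE , o-odd , eE′
  where
  E<2^r : length E < 2 ^ r
  E<2^r = ≰⇒> (free ∘ HasCZS-++⁺ˡ (o ∷ E′) ∘ HasCZS-evens-of-length≥2^r r E eE)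
  E′<2^r : length E′ < 2 ^ r
  E′<2^r = ≰⇒> (free ∘ HasCZS-++⁺ʳ E ∘ HasCZS-++⁺ʳ (o ∷ []) ∘ HasCZS-evens-of-length≥2^r r E′ eE′)
  lenE : length E ≡ 2 ^ r ∸ 1
  lenE = m+suc[n]≡o+suc[o]⇒m≡o (suc[m]≤n⇒m≤pred[n] E<2^r) (suc[m]≤n⇒m≤pred[n] E′<2^r)
    (trans (sym (length-++ E)) (trans len (sym (n∸1+[1+n∸1]≡2n∸1 (2 ^ r) {{m^n≢0 2 r}}))))

¬HasCZS-++-∷⁻ : ∀ r (S₁ : List (Fin (2 ^ suc r))) x S₂ → length S₁ ≡ 2 ^ r ∸ 1 → length S₂ ≡ 2 ^ r ∸ 1 →
  ¬ HasCZS (2 ^ suc r) (U (2 ^ suc r)) (S₁ ++ x ∷ S₂) →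
  All EvenF S₁ × All EvenF S₂ × OddF x
    × ¬ HasCZS (2 ^ r) (U (2 ^ r)) (map (half r) S₁) × ¬ HasCZS (2 ^ r) (U (2 ^ r)) (map (half r) S₂)
¬HasCZS-++-∷⁻ r S₁ x S₂ len₁ len₂ free
  with E , o , E′ , eq , lenE , eE , o-odd , eE′ ← ¬HasCZS⇒middleOdd r _ (length-++-∷ r S₁ x S₂ len₁ len₂) free
  with refl , refl , refl ← ++-∷-injective S₁ E (trans len₁ (sym lenE)) eq =
  eE , eE′ , o-odd ,
  free ∘ HasCZS-++⁺ˡ (x ∷ S₂) ∘ HasCZS-unhalf r eE ,
  free ∘ HasCZS-++⁺ʳ S₁ ∘ HasCZS-++⁺ʳ (x ∷ []) ∘ HasCZS-unhalf r eE′

mainTheorem2 : (r : ℕ) (S₁ : List (Fin (2 ^ suc r))) (x : Fin (2 ^ suc r)) (S₂ : List (Fin (2 ^ suc r))) →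
    length S₁ ≡ 2 ^ r ∸ 1 → length S₂ ≡ 2 ^ r ∸ 1 →
    (CExtremal (2 ^ suc r) (U (2 ^ suc r)) (S₁ ++ x ∷ S₂)
      ⇔ (All EvenF S₁ × All EvenF S₂ × OddF x
         × CExtremal (2 ^ r) (U (2 ^ r)) (map (half r) S₁)
         × CExtremal (2 ^ r) (U (2 ^ r)) (map (half r) S₂)))
mainTheorem2 r S₁ x S₂ len₁ len₂ = mk⇔ to from
  where
  Halves : Set
  Halves = All EvenF S₁ × All EvenF S₂ × OddF x
         × CExtremal (2 ^ r) (U (2 ^ r)) (map (half r) S₁) × CExtremal (2 ^ r) (U (2 ^ r)) (map (half r) S₂)
  to : CExtremal (2 ^ suc r) (U (2 ^ suc r)) (S₁ ++ x ∷ S₂) → Halves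
  to (_ , _ , _ , free) with eS₁ , eS₂ , x-odd , free₁ , free₂ ← ¬HasCZS-++-∷⁻ r S₁ x S₂ len₁ len₂ free =
    eS₁ , eS₂ , x-odd ,
    ¬HasCZS⇒CExtremal r _ (trans (length-map (half r) S₁) len₁) free₁ ,
    ¬HasCZS⇒CExtremal r _ (trans (length-map (half r) S₂) len₂) free₂
  from : Halves → CExtremal (2 ^ suc r) (U (2 ^ suc r)) (S₁ ++ x ∷ S₂)
  from (eS₁ , eS₂ , x-odd , (_ , _ , _ , free₁) , (_ , _ , _ , free₂)) =
    ¬HasCZS⇒CExtremal (suc r) _ (length-++-∷ r S₁ x S₂ len₁ len₂)
      (¬HasCZS-++-∷⁺ r S₁ x S₂ eS₁ eS₂ x-odd free₁ free₂)
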